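{- Let $M=\{1^{k_{1}},2^{k_{2}},\ldots,m^{k_{m}}\}$ with $k_{i}\geq1$ for all $i\in[m]$, and let $w\in\mathfrak{S}_M$. Then $\mathrm{Des}(\mathrm{istd}_M(\Psi(\mathrm{std}(w))))=\mathrm{Des}(\Psi(\mathrm{std}(w)))$.
   Context: $\mathfrak{S}_M$: words of length $n=\sum k_i$ that are rearrangements of $M$. $\mathrm{Des}(u)=\{i:u_i>u_{i+1}\}$. $\mathrm{std}(w)\in\mathfrak{S}_n$ is the permutation $\pi$ with $\pi_i<\pi_j$ iff $w_i<w_j$, or $w_i=w_j$ and $i<j$. $\mathrm{istd}_M:\mathfrak{S}_n\to\mathfrak{S}_M$ replaces the letters $1,\dots,k_1$ by $1$, the letters $k_1+1,\dots,k_1+k_2$ by $2$, ..., the last $k_m$ letters $n-k_m+1,\dots,n$ by $m$. For $\pi\in\mathfrak{S}_n$, $I(\pi)=(c_1,\dots,c_n)$ where $c_i$ is the number of letters $j<i$ to the right of $i$ in $\pi$. $\Psi:\mathfrak{S}_n\to\mathfrak{S}_n$ is defined recursively: $\Psi(1)=1$; for $n\ge2$ let $\pi'$ be $\pi$ with $n$ deleted; label the $n$ gaps of $\Psi(\pi')$: (a) the gap after the last letter gets $0$; (b) the gaps immediately following the descents of $\Psi(\pi')$ get $1,\dots,\mathrm{des}(\Psi(\pi'))$ from right to left; (c) the remaining gaps get $\mathrm{des}(\Psi(\pi'))+1,\dots,n-1$ from left to right; insert $n$ into the gap labeled $c_n$ to obtain $\Psi(\pi)$. -}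

module Defs where

open import Data.Nat using (ℕ; zero; suc; _+_; _∸_; _<_; _≤_; _<?_; _≤?_; _≟_)
open import Data.List using (List; []; _∷_; _++_; [_]; length; filter; reverse; replicate; concat; map; upTo; take; drop)
open import Data.List.Membership.DecPropositional _≟_ using (_∉?_)
open import Relation.Nullary.Decidable using (yes; no; ¬?)

-- Words and permutations are lists of positive naturals (letters).
-- Positions in descent sets are 1-indexed, as in the paper.

countLt : ℕ → List ℕ → ℕ
countLt x w = length (filter (λ y → y <? x) w)

countEq : ℕ → List ℕ → ℕ
countEq x w = length (filter (λ y → y ≟ x) w)

desFrom : ℕ → ℕ → List ℕ → List ℕ
desFrom i x [] = []
desFrom i x (y ∷ ys) with y <? x
... | yes _ = i ∷ desFrom (suc i) y ys
... | no  _ = desFrom (suc i) y ys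

Des : List ℕ → List ℕ
Des [] = []
Des (x ∷ xs) = desFrom 1 x xs

baseFrom : ℕ → List ℕ → List ℕ
baseFrom i [] = []
baseFrom i (k ∷ ks) = replicate k i ++ baseFrom (suc i) ks

baseWord : List ℕ → List ℕ
baseWord ks = baseFrom 1 ks

stdGo : List ℕ → List ℕ → List ℕ → List ℕ
stdGo w pre [] = []
stdGo w pre (x ∷ xs) = suc (countLt x w + countEq x pre) ∷ stdGo w (pre ++ [ x ]) xs

std : List ℕ → List ℕ
std w = stdGo w [] w

-- istd_M on letters: v ∈ {k_1+...+k_{t-1}+1, ..., k_1+...+k_t} is sent to t.
istdLetter : List ℕ → ℕ → ℕ → ℕ
istdLetter [] t v = t
istdLetter (k ∷ ks) t v with v ≤? k
... | yes _ = t
... | no  _ = istdLetter ks (suc t) (v ∸ k)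

istd : List ℕ → List ℕ → List ℕ
istd ks π = map (istdLetter ks 1) π

rightOf : ℕ → List ℕ → List ℕ
rightOf i [] = []
rightOf i (x ∷ xs) with x ≟ i
... | yes _ = xs
... | no  _ = rightOf i xs

invCode : List ℕ → List ℕ
invCode π = map (λ i → countLt i (rightOf i π)) (map suc (upTo (length π)))

-- 0-indexed lookup with default 0
nth : List ℕ → ℕ → ℕ
nth [] _ = 0
nth (x ∷ xs) zero = x
nth (x ∷ xs) (suc j) = nth xs j

-- Gaps of a word u of length L are numbered 0..L (gap g lies after the first g letters).
-- Labels: gap L gets 0; gaps right after descents get 1..des(u) from right to left;
-- the remaining gaps get des(u)+1, ..., L from left to right.
-- gapOrder u lists the gaps in order of their labels.
gapOrder : List ℕ → List ℕ
gapOrder u = length u ∷ (reverse (Des u) ++ filter (λ g → g ∉? Des u) (upTo (length u)))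

gapOfLabel : List ℕ → ℕ → ℕ
gapOfLabel u c = nth (gapOrder u) c

insertAtGap : ℕ → ℕ → List ℕ → List ℕ
insertAtGap g a u = take g u ++ a ∷ drop g u

removeLetter : ℕ → List ℕ → List ℕ
removeLetter a π = filter (λ y → ¬? (y ≟ a)) π

psiGo : ℕ → List ℕ → List ℕ
psiGo zero π = []
psiGo (suc n) π =
  insertAtGap (gapOfLabel u (nth (invCode π) n)) (suc n) u
  where u = psiGo n (removeLetter (suc n) π)

Ψ : List ℕ → List ℕ
Ψ π = psiGo (length π) π

-- Since istd_M is weakly increasing, Des (istd_M u) = Des u as soon as u has no descent between two
-- letters of the same block (letters with the same image under istd_M).  In π = std w each block
-- occurs from left to right in increasing order; hence if j and j + 1 lie in one block then j is
-- left of j + 1, and the codes satisfy c_{j+1} ≤ c_j.  Building Ψ(π) by inserting 1, 2, ..., n,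
-- one keeps the invariant that the gaps directly in front of the letters of the block of j carry
-- labels larger than c_j.  This survives the insertion of j because inserting a maximal letter
-- into the gap g labelled c sends every gap of label ≤ c either to the gap right after the new
-- letter or to the image of a gap of the old word with label ≤ c (other than g).  When j + 1
-- joins the block of j it is inserted into a gap of label c_{j+1} ≤ c_j, so never in front of a
-- letter of its block, and no descent inside a block ever arises.

module Submission where

open import Defs
open import Data.Nat using (ℕ; zero; suc; _+_; _∸_; _<_; _≤_; _<?_; _≤?_; _≟_; z≤n; s≤s)
open import Data.Nat.Properties
open import Data.List using (List; []; _∷_; _++_; [_]; length; filter; reverse; replicate; map; upTo; applyUpTo; take; drop)
open import Data.List.Properties
  using (length-++; ++-assoc; reverse-++; length-reverse; length-map; upTo-∷ʳ; length-upTo; map-upTo;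
         filter-++; filter-accept; filter-reject; filter-all; filter-none; take++drop≡id; length-filter; length-replicate)
open import Data.List.Membership.Propositional using (_∈_; _∉_)
open import Data.List.Membership.Propositional.Properties
  using (∈-++⁺ˡ; ∈-++⁺ʳ; ∈-++⁻; ∈-∃++; ∈-map⁺; ∈-map⁻; ∈-filter⁻; ∈-upTo⁺; ∈-upTo⁻)
open import Data.List.Membership.DecPropositional _≟_ using (_∈?_; _∉?_)
open import Data.List.Relation.Unary.Any using (here; there)
open import Data.List.Relation.Unary.Any.Properties using (reverse⁺; reverse⁻)
open import Data.List.Relation.Unary.All as All using (All; []; _∷_)
open import Data.List.Relation.Unary.All.Properties using (++⁺; take⁺; drop⁺; filter⁺; all-upTo; replicate⁺)
open import Data.List.Relation.Unary.AllPairs as AllPairs using (AllPairs; []; _∷_)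
open import Data.List.Relation.Unary.Unique.Propositional using (Unique)
open import Data.List.Relation.Unary.Linked as Linked using (Linked; []; [-]; _∷_)
import Data.List.Relation.Unary.Unique.Propositional.Properties as Unique
import Data.List.Relation.Unary.AllPairs.Properties as AllPairsₚ
open import Data.List.Relation.Binary.Permutation.Propositional using (_↭_)
open import Data.List.Relation.Binary.Permutation.Propositional.Properties using (filter-↭; ↭-length; ∈-resp-↭)
open import Data.Product using (∃; _×_; _,_; proj₁; proj₂; map₁)
open import Function using (_∘_; id)
open import Data.Sum as Sum using (_⊎_; inj₁; inj₂)
open import Data.Empty using (⊥-elim)
open import Data.Unit using (⊤; tt)
open import Relation.Nullary using (¬_; Dec; yes; no)
open import Relation.Nullary.Decidable using (¬?)
open import Relation.Binary.PropositionalEquality hiding ([_])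

nth-++ˡ : ∀ xs ys i → i < length xs → nth (xs ++ ys) i ≡ nth xs i
nth-++ˡ (x ∷ xs) ys zero    _         = refl
nth-++ˡ (x ∷ xs) ys (suc i) (s≤s i<) = nth-++ˡ xs ys i i<

nth-++ʳ : ∀ xs ys i → nth (xs ++ ys) (length xs + i) ≡ nth ys i
nth-++ʳ []       ys i = refl
nth-++ʳ (x ∷ xs) ys i = nth-++ʳ xs ys i

nth-∈-take : ∀ xs i → i < length xs → nth xs i ∈ take (suc i) xs
nth-∈-take (x ∷ xs) zero    _        = here refl
nth-∈-take (x ∷ xs) (suc i) (s≤s i<) = there (nth-∈-take xs i i<)

∈-take⇒∈ : ∀ {h : ℕ} i xs → h ∈ take i xs → h ∈ xs
∈-take⇒∈ (suc i) (x ∷ xs) (here p)  = here p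
∈-take⇒∈ (suc i) (x ∷ xs) (there p) = there (∈-take⇒∈ i xs p)

nth-∈ : ∀ xs i → i < length xs → nth xs i ∈ xs
nth-∈ xs i i< = ∈-take⇒∈ (suc i) xs (nth-∈-take xs i i<)

nth-map : ∀ (f : ℕ → ℕ) xs i → i < length xs → nth (map f xs) i ≡ f (nth xs i)
nth-map f (x ∷ xs) zero    _        = refl
nth-map f (x ∷ xs) (suc i) (s≤s i<) = nth-map f xs i i<

nth-applyUpTo : ∀ (f : ℕ → ℕ) n i → i < n → nth (applyUpTo f n) i ≡ f i
nth-applyUpTo f (suc n) zero    _        = refl
nth-applyUpTo f (suc n) (suc i) (s≤s i<) = nth-applyUpTo (λ j → f (suc j)) n i i<
  where open import Function using (_∘′_)

∈-take-mono : ∀ {h : ℕ} {i j} xs → i ≤ j → h ∈ take i xs → h ∈ take j xs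
∈-take-mono {i = suc i} {suc j} (x ∷ xs) (s≤s i≤j) (here p)  = here p
∈-take-mono {i = suc i} {suc j} (x ∷ xs) (s≤s i≤j) (there p) = there (∈-take-mono xs i≤j p)

∈-take-++⁻ : ∀ {h : ℕ} k ys zs → k ≤ length ys → h ∈ take k (ys ++ zs) → h ∈ ys
∈-take-++⁻ (suc k) (y ∷ ys) zs (s≤s k≤) (here p)  = here p
∈-take-++⁻ (suc k) (y ∷ ys) zs (s≤s k≤) (there p) = there (∈-take-++⁻ k ys zs k≤ p)

∈-take-++⁺ : ∀ {h : ℕ} k ys zs → length ys ≤ k → h ∈ ys → h ∈ take k (ys ++ zs)
∈-take-++⁺ (suc k) (y ∷ ys) zs (s≤s ≤k) (here p)  = here p
∈-take-++⁺ (suc k) (y ∷ ys) zs (s≤s ≤k) (there p) = there (∈-take-++⁺ k ys zs ≤k p)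

∈-delete : ∀ {y x : ℕ} xs zs → y ≢ x → y ∈ xs ++ x ∷ zs → y ∈ xs ++ zs
∈-delete []       zs y≢x (here p)  = ⊥-elim (y≢x p)
∈-delete []       zs y≢x (there p) = p
∈-delete (_ ∷ xs) zs y≢x (here p)  = here p
∈-delete (_ ∷ xs) zs y≢x (there p) = there (∈-delete xs zs y≢x p)

unique-⊆⇒length≤ : ∀ xs ys → Unique xs → (∀ {y} → y ∈ xs → y ∈ ys) → length xs ≤ length ys
unique-⊆⇒length≤ []       ys _           _   = z≤n
unique-⊆⇒length≤ (x ∷ xs) ys (x∉xs ∷ u) xs⊆ with ∈-∃++ (xs⊆ (here refl))
... | ys₁ , ys₂ , refl = begin
  suc (length xs)             ≤⟨ s≤s (unique-⊆⇒length≤ xs (ys₁ ++ ys₂) u xs⊆ys₁ys₂) ⟩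
  suc (length (ys₁ ++ ys₂))   ≡⟨ cong suc (length-++ ys₁) ⟩
  suc (length ys₁ + length ys₂) ≡⟨ sym (+-suc (length ys₁) (length ys₂)) ⟩
  length ys₁ + suc (length ys₂) ≡⟨ sym (length-++ ys₁) ⟩
  length (ys₁ ++ x ∷ ys₂)     ∎
  where
  open ≤-Reasoning
  xs⊆ys₁ys₂ : ∀ {y} → y ∈ xs → y ∈ ys₁ ++ ys₂
  xs⊆ys₁ys₂ y∈ = ∈-delete ys₁ ys₂ (λ { refl → All.lookup x∉xs y∈ refl }) (xs⊆ (there y∈))

_∖_ : List ℕ → List ℕ → List ℕ
xs ∖ D = filter (λ g → g ∉? D) xs

length-filter-∈+∖ : ∀ xs D → length xs ≡ length (filter (_∈? D) xs) + length (xs ∖ D)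
length-filter-∈+∖ []       D = refl
length-filter-∈+∖ (x ∷ xs) D with x ∈? D
... | yes _ = cong suc (length-filter-∈+∖ xs D)
... | no  _ = trans (cong suc (length-filter-∈+∖ xs D)) (sym (+-suc _ _))

unique-length≤ : ∀ xs D → Unique xs → length xs ≤ length D + length (xs ∖ D)
unique-length≤ xs D u = begin
  length xs                                        ≡⟨ length-filter-∈+∖ xs D ⟩
  length (filter (_∈? D) xs) + length (xs ∖ D)     ≤⟨ +-monoˡ-≤ _ filtered≤ ⟩
  length D + length (xs ∖ D)                       ∎
  where
  open ≤-Reasoning
  filtered≤ : length (filter (_∈? D) xs) ≤ length D
  filtered≤ = unique-⊆⇒length≤ _ D (Unique.filter⁺ (_∈? D) u) (λ y∈ → proj₂ (∈-filter⁻ (_∈? D) {xs = xs} y∈))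

last : ℕ → List ℕ → ℕ
last x []       = x
last x (y ∷ ys) = last y ys

last-∈ : ∀ x ys → last x ys ∈ x ∷ ys
last-∈ x []       = here refl
last-∈ x (y ∷ ys) = there (last-∈ y ys)

desFrom-++ : ∀ i x ys zs →
  desFrom i x (ys ++ zs) ≡ desFrom i x ys ++ desFrom (i + length ys) (last x ys) zs
desFrom-++ i x []       zs rewrite +-identityʳ i = refl
desFrom-++ i x (y ∷ ys) zs with y <? x
... | yes _ rewrite +-suc i (length ys) = cong (i ∷_) (desFrom-++ (suc i) y ys zs)
... | no  _ rewrite +-suc i (length ys) = desFrom-++ (suc i) y ys zs

desFrom-suc : ∀ i x ys → desFrom (suc i) x ys ≡ map suc (desFrom i x ys)
desFrom-suc i x []       = refl
desFrom-suc i x (y ∷ ys) with y <? x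
... | yes _ = cong (suc i ∷_) (desFrom-suc (suc i) y ys)
... | no  _ = desFrom-suc (suc i) y ys

bounds-suc : ∀ {i n d} → suc i ≤ d × d < suc i + n → i ≤ d × d < i + suc n
bounds-suc {i} {n} {d} (i<d , d<) = <⇒≤ i<d , subst (d <_) (sym (+-suc i n)) d<

desFrom-bounds : ∀ i x ys → All (λ d → i ≤ d × d < i + length ys) (desFrom i x ys)
desFrom-bounds i x []       = []
desFrom-bounds i x (y ∷ ys) with y <? x
... | yes _ = (≤-refl , subst (i <_) (sym (+-suc i (length ys))) (m≤m+n (suc i) (length ys)))
              ∷ All.map bounds-suc (desFrom-bounds (suc i) y ys)
... | no  _ = All.map bounds-suc (desFrom-bounds (suc i) y ys)

Des-< : ∀ u → All (_< length u) (Des u)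
Des-< []       = []
Des-< (x ∷ xs) = All.map proj₂ (desFrom-bounds 1 x xs)

desFrom-descent : ∀ i x y ys → y < x → desFrom i x (y ∷ ys) ≡ i ∷ desFrom (suc i) y ys
desFrom-descent i x y ys y<x with y <? x
... | yes _   = refl
... | no  y≮x = ⊥-elim (y≮x y<x)

desFrom-ascent : ∀ i x y ys → x < y → desFrom i x (y ∷ ys) ≡ desFrom (suc i) y ys
desFrom-ascent i x y ys x<y with y <? x
... | yes y<x = ⊥-elim (<-asym y<x x<y)
... | no  _   = refl

DescentSeparated : (ℕ → ℕ) → ℕ → ℕ → Set
DescentSeparated f x y = y < x → f y ≢ f x

module _ {f : ℕ → ℕ} (f-mono : ∀ {x y} → x ≤ y → f x ≤ f y) where

  desFrom-map : ∀ i x ys → Linked (DescentSeparated f) (x ∷ ys) → desFrom i (f x) (map f ys) ≡ desFrom i x ys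
  desFrom-map i x []       _               = refl
  desFrom-map i x (y ∷ ys) (separated ∷ l) with f y <? f x | y <? x
  ... | yes _       | yes _   = cong (i ∷_) (desFrom-map (suc i) y ys l)
  ... | yes fy<fx   | no  y≮x = ⊥-elim (<-irrefl refl (<-≤-trans fy<fx (f-mono (≮⇒≥ y≮x))))
  ... | no  fy≮fx   | yes y<x = ⊥-elim (fy≮fx (≤∧≢⇒< (f-mono (<⇒≤ y<x)) (separated y<x)))
  ... | no  _       | no  _   = desFrom-map (suc i) y ys l

  Des-map : ∀ u → Linked (DescentSeparated f) u → Des (map f u) ≡ Des u
  Des-map []      _ = refl
  Des-map (x ∷ u) l = desFrom-map 1 x u l

record DesInsertion (P S : List ℕ) (a : ℕ) : Set where
  field
    before atP after : List ℕ
    Des-old  : Des (P ++ S) ≡ before ++ atP ++ after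
    Des-new  : Des (P ++ a ∷ S) ≡ before ++ suc (length P) ∷ map suc after
    before-< : All (_< length P) before
    after->  : All (length P <_) after
    atP-⊆    : atP ≡ [] ⊎ atP ≡ [ length P ]

desInsertion : ∀ P s S a → All (_< a) (P ++ s ∷ S) → DesInsertion P (s ∷ S) a
desInsertion [] s S a <a = record
  { before = [] ; atP = [] ; after = desFrom 1 s S
  ; Des-old = refl
  ; Des-new = trans (desFrom-descent 1 a s S (All.lookup <a (here refl))) (cong (1 ∷_) (desFrom-suc 1 s S))
  ; before-< = [] ; after-> = All.map proj₁ (desFrom-bounds 1 s S) ; atP-⊆ = inj₁ refl }
desInsertion (p ∷ P) s S a <a = record
  { before = desFrom 1 p P ; atP = atP ; after = desFrom (suc g) s S
  ; Des-old = trans (desFrom-++ 1 p P (s ∷ S)) (cong (desFrom 1 p P ++_) old-tail)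
  ; Des-new = trans (desFrom-++ 1 p P (a ∷ s ∷ S)) (cong (desFrom 1 p P ++_) new-tail)
  ; before-< = All.map proj₂ (desFrom-bounds 1 p P)
  ; after-> = All.map proj₁ (desFrom-bounds (suc g) s S)
  ; atP-⊆ = atP-⊆ }
  where
  g = suc (length P)
  ℓ = last p P
  atP : List ℕ
  atP with s <? ℓ
  ... | yes _ = [ g ]
  ... | no  _ = []
  atP-⊆ : atP ≡ [] ⊎ atP ≡ [ g ]
  atP-⊆ with s <? ℓ
  ... | yes _ = inj₂ refl
  ... | no  _ = inj₁ refl
  old-tail : desFrom g ℓ (s ∷ S) ≡ atP ++ desFrom (suc g) s S
  old-tail with s <? ℓ
  ... | yes _ = refl
  ... | no  _ = refl
  new-tail : desFrom g ℓ (a ∷ s ∷ S) ≡ suc g ∷ map suc (desFrom (suc g) s S)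
  new-tail = begin
    desFrom g ℓ (a ∷ s ∷ S)              ≡⟨ desFrom-ascent g ℓ a (s ∷ S) (All.lookup <a (∈-++⁺ˡ (last-∈ p P))) ⟩
    desFrom (suc g) a (s ∷ S)            ≡⟨ desFrom-descent (suc g) a s S (All.lookup <a (∈-++⁺ʳ (p ∷ P) (here refl))) ⟩
    suc g ∷ desFrom (suc (suc g)) s S    ≡⟨ cong (suc g ∷_) (desFrom-suc (suc g) s S) ⟩
    suc g ∷ map suc (desFrom (suc g) s S) ∎
    where open ≡-Reasoning

reverse⁺-All : ∀ {P : ℕ → Set} {xs} → All P xs → All P (reverse xs)
reverse⁺-All Pxs = All.tabulate (λ x∈ → All.lookup Pxs (reverse⁻ x∈))

nth-≢ : ∀ {g : ℕ} xs i → All (_≢ g) xs → i < length xs → nth xs i ≢ g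
nth-≢ xs i xs≢g i< = All.lookup xs≢g (nth-∈ xs i i<)

nth≡-middle : ∀ {g : ℕ} A B C i → All (_≢ g) A → All (_≢ g) C → B ≡ [] ⊎ B ≡ [ g ] →
  i < length A + (length B + length C) → nth (A ++ B ++ C) i ≡ g → i ≡ length A × B ≡ [ g ]
nth≡-middle []      _ C i       _ C≢g (inj₁ refl) i<       eq = ⊥-elim (nth-≢ C i C≢g i< eq)
nth≡-middle []      _ C zero    _ C≢g (inj₂ refl) _        eq = refl , refl
nth≡-middle []      _ C (suc i) _ C≢g (inj₂ refl) (s≤s i<) eq = ⊥-elim (nth-≢ C i C≢g i< eq)
nth≡-middle (x ∷ A) B C zero    (x≢g ∷ _) _ _ _ eq = ⊥-elim (x≢g eq)
nth≡-middle (x ∷ A) B C (suc i) (_ ∷ A≢g) C≢g B⊆ (s≤s i<) eq =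
  map₁ (cong suc) (nth≡-middle A B C i A≢g C≢g B⊆ i< eq)

∖-cong : ∀ xs {D D'} → (∀ {y} → y ∈ xs → y ∈ D → y ∈ D') → (∀ {y} → y ∈ xs → y ∈ D' → y ∈ D) →
  xs ∖ D ≡ xs ∖ D'
∖-cong []       _    _    = refl
∖-cong (x ∷ xs) {D} {D'} D⊆D' D'⊆D with x ∈? D | x ∈? D'
... | yes _   | yes _    = ∖-cong xs (D⊆D' ∘ there) (D'⊆D ∘ there)
... | yes x∈D | no  x∉D' = ⊥-elim (x∉D' (D⊆D' (here refl) x∈D))
... | no  x∉D | yes x∈D' = ⊥-elim (x∉D (D'⊆D (here refl) x∈D'))
... | no  _   | no  _    = cong (x ∷_) (∖-cong xs (D⊆D' ∘ there) (D'⊆D ∘ there))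

upTo-split : ∀ {g L} → g < L → ∃ λ R → upTo L ≡ upTo g ++ g ∷ R × All (g <_) R
upTo-split {g} {suc L} (s≤s g≤L) with g ≟ L
... | yes refl = [] , sym (upTo-∷ʳ g) , []
... | no  g≢L with upTo-split (≤∧≢⇒< g≤L g≢L)
...   | R , upTo-L , g<R = R ++ [ L ] , eq , ++⁺ g<R (≤∧≢⇒< g≤L g≢L ∷ [])
  where
  eq : upTo (suc L) ≡ upTo g ++ g ∷ R ++ [ L ]
  eq = begin
    upTo (suc L)              ≡⟨ sym (upTo-∷ʳ L) ⟩
    upTo L ++ [ L ]           ≡⟨ cong (_++ [ L ]) upTo-L ⟩
    (upTo g ++ g ∷ R) ++ [ L ] ≡⟨ ++-assoc (upTo g) (g ∷ R) [ L ] ⟩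
    upTo g ++ g ∷ R ++ [ L ]  ∎
    where open ≡-Reasoning

upTo-∖-split : ∀ {g L} D → g < L → g ∉ D →
  ∃ λ R → upTo L ∖ D ≡ upTo g ∖ D ++ g ∷ R × All (g <_) R
upTo-∖-split {g} {L} D g<L g∉D with upTo-split g<L
... | R , upTo-L , g<R = R ∖ D , eq , filter⁺ (λ y → y ∉? D) g<R
  where
  eq : upTo L ∖ D ≡ upTo g ∖ D ++ g ∷ R ∖ D
  eq = begin
    upTo L ∖ D                 ≡⟨ cong (_∖ D) upTo-L ⟩
    (upTo g ++ g ∷ R) ∖ D      ≡⟨ filter-++ (λ y → y ∉? D) (upTo g) (g ∷ R) ⟩
    upTo g ∖ D ++ (g ∷ R) ∖ D  ≡⟨ cong (upTo g ∖ D ++_) (filter-accept (λ y → y ∉? D) g∉D) ⟩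
    upTo g ∖ D ++ g ∷ R ∖ D    ∎
    where open ≡-Reasoning

-- How a gap h0 ≠ g of u reappears in the word obtained by inserting a letter into gap g.
data GapImage (g : ℕ) : ℕ → ℕ → Set where
  left  : ∀ {h} → h < g → GapImage g h h
  right : ∀ {h} → g < h → GapImage g h (suc h)

-- D and D' are the descent sets of u and of u with a maximal letter inserted at gap g (cf. DesInsertion);
-- Old and New are the gap orders of these words without their first entry (the final gap), and g has label c + 1 in u.
module LowLabels {L g c : ℕ} {before atP after : List ℕ}
  (g<L : g < L) (before-< : All (_< g) before) (after-> : All (g <_) after)
  (atP-⊆ : atP ≡ [] ⊎ atP ≡ [ g ]) (c<L : c < L)
  (label-g : nth (reverse (before ++ atP ++ after) ++ upTo L ∖ (before ++ atP ++ after)) c ≡ g)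
  where

  D D' Old New : List ℕ
  D   = before ++ atP ++ after
  D'  = before ++ suc g ∷ map suc after
  Old = reverse D ++ upTo L ∖ D
  New = reverse D' ++ upTo (suc L) ∖ D'

  Inherited : ℕ → Set
  Inherited h = h ≡ suc g ⊎ ∃ λ h0 → h0 ∈ take (suc c) Old × GapImage g h0 h

  reverse-D : reverse D ≡ reverse after ++ reverse atP ++ reverse before
  reverse-D = begin
    reverse (before ++ atP ++ after)                   ≡⟨ reverse-++ before (atP ++ after) ⟩
    reverse (atP ++ after) ++ reverse before            ≡⟨ cong (_++ reverse before) (reverse-++ atP after) ⟩
    (reverse after ++ reverse atP) ++ reverse before    ≡⟨ ++-assoc (reverse after) (reverse atP) (reverse before) ⟩
    reverse after ++ reverse atP ++ reverse before      ∎
    where open ≡-Reasoning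

  after≢g : All (_≢ g) after
  after≢g = All.map (λ g<x x≡g → <-irrefl (sym x≡g) g<x) after->

  before≢g : All (_≢ g) before
  before≢g = All.map (λ x<g x≡g → <-irrefl x≡g x<g) before-<

  -- Gap g is the (c + 1)-st descent of u from the right; the first c + 1 entries of New are g + 1 and the shifted descents after g.
  module Descent (c<D : c < length D) where

    Y : List ℕ
    Y = suc g ∷ map suc after

    reverse-atP-⊆ : reverse atP ≡ [] ⊎ reverse atP ≡ [ g ]
    reverse-atP-⊆ = Sum.map (cong reverse) (cong reverse) atP-⊆

    c≡after : c ≡ length (reverse after)
    c≡after = proj₁ (nth≡-middle (reverse after) (reverse atP) (reverse before) c
                (reverse⁺-All after≢g) (reverse⁺-All before≢g) reverse-atP-⊆ (subst (c <_) length-rD c<rD)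
                (subst (λ z → nth z c ≡ g) reverse-D (trans (sym (nth-++ˡ (reverse D) _ c c<rD)) label-g)))
      where
      c<rD : c < length (reverse D)
      c<rD = subst (c <_) (sym (length-reverse D)) c<D
      length-rD : length (reverse D) ≡ length (reverse after) + (length (reverse atP) + length (reverse before))
      length-rD = trans (cong length reverse-D)
                    (trans (length-++ (reverse after)) (cong (length (reverse after) +_) (length-++ (reverse atP))))

    length-Y : length (reverse Y) ≡ suc c
    length-Y = trans (length-reverse Y)
                 (cong suc (trans (length-map suc after) (trans (sym (length-reverse after)) (sym c≡after))))

    New≡ : New ≡ reverse Y ++ reverse before ++ upTo (suc L) ∖ D'
    New≡ = trans (cong (_++ upTo (suc L) ∖ D') (reverse-++ before Y)) (++-assoc (reverse Y) (reverse before) _)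

    after⊆Old : ∀ {x} → x ∈ after → x ∈ take (suc c) Old
    after⊆Old {x} x∈after =
      subst (λ z → x ∈ take (suc c) z) (sym (trans (cong (_++ upTo L ∖ D) reverse-D) (++-assoc (reverse after) _ _)))
        (∈-take-++⁺ (suc c) (reverse after) _ (≤-trans (≤-reflexive (sym c≡after)) (n≤1+n c)) (reverse⁺ x∈after))

    inherited : ∀ {h} → h ∈ take (suc c) New → Inherited h
    inherited h∈ with reverse⁻ {xs = Y} (∈-take-++⁻ (suc c) (reverse Y) _ (≤-reflexive (sym length-Y)) (subst (λ z → _ ∈ take (suc c) z) New≡ h∈))
    ... | here h≡ = inj₁ h≡
    ... | there h∈ with ∈-map⁻ suc h∈
    ...   | x , x∈after , refl = inj₂ (x , after⊆Old x∈after , right (All.lookup after-> x∈after))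

  -- Gap g is not a descent of u; below g the descents and hence the non-descent gaps of u and u' agree.
  module Ascent (D≤c : length D ≤ c) where

    k : ℕ
    k = c ∸ length D

    c≡ : c ≡ length D + k
    c≡ = sym (m+[n∸m]≡n D≤c)

    ND NL : List ℕ
    ND = upTo L ∖ D
    NL = upTo g ∖ D

    ND-k : nth ND k ≡ g
    ND-k = begin
      nth ND k                           ≡⟨ sym (nth-++ʳ (reverse D) ND k) ⟩
      nth Old (length (reverse D) + k)   ≡⟨ cong (λ z → nth Old (z + k)) (length-reverse D) ⟩
      nth Old (length D + k)             ≡⟨ cong (nth Old) (sym c≡) ⟩
      nth Old c                          ≡⟨ label-g ⟩
      g                                  ∎
      where open ≡-Reasoning

    k<ND : k < length ND
    k<ND = +-cancelˡ-< (length D) k (length ND) (begin-strict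
      length D + k        ≡⟨ sym c≡ ⟩
      c                   <⟨ c<L ⟩
      L                   ≡⟨ sym (length-upTo L) ⟩
      length (upTo L)     ≤⟨ unique-length≤ (upTo L) D (Unique.upTo⁺ L) ⟩
      length D + length ND ∎)
      where open ≤-Reasoning

    g∉D : g ∉ D
    g∉D = proj₂ (∈-filter⁻ (λ y → y ∉? D) {xs = upTo L} (subst (_∈ ND) ND-k (nth-∈ ND k k<ND)))

    atP≡[] : atP ≡ []
    atP≡[] = Sum.[ id , (λ { refl → ⊥-elim (g∉D (∈-++⁺ʳ before (here refl))) }) ]′ atP-⊆

    NL<g : All (_< g) NL
    NL<g = filter⁺ (λ y → y ∉? D) (all-upTo g)

    ND-split : ∃ λ NR → ND ≡ NL ++ g ∷ NR × All (g <_) NR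
    ND-split = upTo-∖-split D g<L g∉D

    NR : List ℕ
    NR = proj₁ ND-split

    k≡NL : k ≡ length NL
    k≡NL = proj₁ (nth≡-middle NL [ g ] NR k
             (All.map (λ y<g y≡g → <-irrefl y≡g y<g) NL<g)
             (All.map (λ g<y y≡g → <-irrefl (sym y≡g) g<y) (proj₂ (proj₂ ND-split))) (inj₂ refl)
             (subst (k <_) (trans (cong length (proj₁ (proj₂ ND-split))) (length-++ NL)) k<ND)
             (subst (λ z → nth z k ≡ g) (proj₁ (proj₂ ND-split)) ND-k))

    D⊆Old : ∀ {y} → y ∈ D → y ∈ take (suc c) Old
    D⊆Old y∈ = ∈-take-++⁺ (suc c) (reverse D) ND
                 (≤-trans (≤-reflexive (length-reverse D)) (≤-trans D≤c (n≤1+n c))) (reverse⁺ y∈)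

    NL⊆Old : ∀ {y} → y ∈ NL → y ∈ take (suc c) Old
    NL⊆Old {y} y∈ = subst (λ z → y ∈ take (suc c) z) Old≡
      (∈-take-++⁺ (suc c) (reverse D ++ NL) (g ∷ NR) length≤ (∈-++⁺ʳ (reverse D) y∈))
      where
      Old≡ : (reverse D ++ NL) ++ g ∷ NR ≡ Old
      Old≡ = trans (++-assoc (reverse D) NL (g ∷ NR)) (cong (reverse D ++_) (sym (proj₁ (proj₂ ND-split))))
      length≤ : length (reverse D ++ NL) ≤ suc c
      length≤ = ≤-trans (≤-reflexive (trans (length-++ (reverse D))
                  (cong₂ _+_ (length-reverse D) (sym k≡NL)))) (≤-trans (≤-reflexive (sym c≡)) (n≤1+n c))

    D'-below-g : ∀ {y} → y < g → y ∈ D' → y ∈ before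
    D'-below-g y<g y∈ with ∈-++⁻ before y∈
    ... | inj₁ y∈before  = y∈before
    ... | inj₂ (here refl) = ⊥-elim (<-asym y<g (n<1+n g))
    ... | inj₂ (there y∈) with ∈-map⁻ suc y∈
    ...   | x , x∈after , refl = ⊥-elim (<-asym y<g (≤-trans (All.lookup after-> x∈after) (n≤1+n x)))

    D-below-g : ∀ {y} → y < g → y ∈ D → y ∈ before
    D-below-g y<g y∈ with ∈-++⁻ before y∈
    ... | inj₁ y∈before = y∈before
    ... | inj₂ y∈ rewrite atP≡[] = ⊥-elim (<-asym y<g (All.lookup after-> y∈))

    g∉D' : g ∉ D'
    g∉D' g∈ with ∈-++⁻ before g∈
    ... | inj₁ g∈before = <-irrefl refl (All.lookup before-< g∈before)
    ... | inj₂ (here g≡) = <-irrefl g≡ (n<1+n g)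
    ... | inj₂ (there g∈) with ∈-map⁻ suc g∈
    ...   | x , x∈after , refl = <-asym (All.lookup after-> x∈after) (n<1+n x)

    New-split : ∃ λ NR' → upTo (suc L) ∖ D' ≡ upTo g ∖ D' ++ g ∷ NR' × All (g <_) NR'
    New-split = upTo-∖-split D' (m<n⇒m<1+n g<L) g∉D'

    NR' : List ℕ
    NR' = proj₁ New-split

    New≡ : New ≡ (reverse D' ++ NL) ++ g ∷ NR'
    New≡ = begin
      reverse D' ++ upTo (suc L) ∖ D'   ≡⟨ cong (reverse D' ++_) (proj₁ (proj₂ New-split)) ⟩
      reverse D' ++ upTo g ∖ D' ++ g ∷ NR' ≡⟨ cong (λ z → reverse D' ++ z ++ g ∷ NR') NL'≡NL ⟩
      reverse D' ++ NL ++ g ∷ NR'       ≡⟨ sym (++-assoc (reverse D') NL (g ∷ NR')) ⟩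
      (reverse D' ++ NL) ++ g ∷ NR'     ∎
      where
      open ≡-Reasoning
      NL'≡NL : upTo g ∖ D' ≡ NL
      NL'≡NL = ∖-cong (upTo g) (λ y∈ y∈D' → ∈-++⁺ˡ (D'-below-g (∈-upTo⁻ y∈) y∈D'))
                                (λ y∈ y∈D → ∈-++⁺ˡ (D-below-g (∈-upTo⁻ y∈) y∈D))

    length-D'NL : length (reverse D' ++ NL) ≡ suc c
    length-D'NL = begin
      length (reverse D' ++ NL)                     ≡⟨ length-++ (reverse D') ⟩
      length (reverse D') + length NL               ≡⟨ cong₂ _+_ (length-reverse D') (sym k≡NL) ⟩
      length (before ++ suc g ∷ map suc after) + k  ≡⟨ cong (_+ k) (length-++ before) ⟩
      length before + suc (length (map suc after)) + k ≡⟨ cong (λ z → length before + suc z + k) (length-map suc after) ⟩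
      length before + suc (length after) + k        ≡⟨ cong (_+ k) (+-suc (length before) (length after)) ⟩
      suc (length before + length after + k)        ≡⟨ cong (λ z → suc (length before + length (z ++ after) + k)) (sym atP≡[]) ⟩
      suc (length before + length (atP ++ after) + k) ≡⟨ cong (λ z → suc (z + k)) (sym (length-++ before)) ⟩
      suc (length D + k)                            ≡⟨ cong suc (sym c≡) ⟩
      suc c                                         ∎
      where open ≡-Reasoning

    inherited : ∀ {h} → h ∈ take (suc c) New → Inherited h
    inherited {h} h∈ with ∈-++⁻ (reverse D') (∈-take-++⁻ (suc c) (reverse D' ++ NL) _ (≤-reflexive (sym length-D'NL))
                                               (subst (λ z → h ∈ take (suc c) z) New≡ h∈))
    ... | inj₂ h∈NL = inj₂ (h , NL⊆Old h∈NL , left (All.lookup NL<g h∈NL))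
    ... | inj₁ h∈D' with ∈-++⁻ before (reverse⁻ h∈D')
    ...   | inj₁ h∈before = inj₂ (h , D⊆Old (∈-++⁺ˡ h∈before) , left (All.lookup before-< h∈before))
    ...   | inj₂ (here h≡) = inj₁ h≡
    ...   | inj₂ (there h∈) with ∈-map⁻ suc h∈
    ...     | x , x∈after , refl =
            inj₂ (x , D⊆Old (∈-++⁺ʳ before (∈-++⁺ʳ atP x∈after)) , right (All.lookup after-> x∈after))

  inherited : ∀ {h} → h ∈ take (suc c) New → Inherited h
  inherited with c <? length D
  ... | yes c<D = Descent.inherited c<D
  ... | no  c≮D = Ascent.inherited (≮⇒≥ c≮D)

InheritsLowGaps : ℕ → ℕ → List ℕ → List ℕ → Set
InheritsLowGaps c g u u' = ∀ {h} → h ∈ take (suc c) (gapOrder u') →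
  h ≡ suc g ⊎ ∃ λ h0 → h0 ∈ take (suc c) (gapOrder u) × GapImage g h0 h

length-insertAtGap : ∀ g a u → length (insertAtGap g a u) ≡ suc (length u)
length-insertAtGap g a u = begin
  length (take g u ++ a ∷ drop g u)            ≡⟨ length-++ (take g u) ⟩
  length (take g u) + suc (length (drop g u))  ≡⟨ +-suc _ _ ⟩
  suc (length (take g u) + length (drop g u))  ≡⟨ cong suc (sym (length-++ (take g u))) ⟩
  suc (length (take g u ++ drop g u))          ≡⟨ cong (suc ∘ length) (take++drop≡id g u) ⟩
  suc (length u)                               ∎
  where open ≡-Reasoning

inheritsLowGaps-insert : ∀ P s S a c → All (_< a) (P ++ s ∷ S) → c < length (P ++ s ∷ S) →
  gapOfLabel (P ++ s ∷ S) (suc c) ≡ length P →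
  InheritsLowGaps (suc c) (length P) (P ++ s ∷ S) (P ++ a ∷ s ∷ S)
inheritsLowGaps-insert P s S a c <a c<u label-g = inherits
  where
  open DesInsertion (desInsertion P s S a <a)
  u u' : List ℕ
  u  = P ++ s ∷ S
  u' = P ++ a ∷ s ∷ S
  length-u' : length u' ≡ suc (length u)
  length-u' = trans (length-++ P) (trans (+-suc (length P) _) (cong suc (sym (length-++ P))))
  g<u : length P < length u
  g<u = subst (length P <_) (sym (length-++ P)) (m<m+n (length P) (s≤s z≤n))
  module Low = LowLabels g<u before-< after-> atP-⊆ c<u
                 (subst (λ D → nth (reverse D ++ upTo (length u) ∖ D) c ≡ length P) Des-old label-g)
  inherits : InheritsLowGaps (suc c) (length P) u u'
  inherits (here refl) = inj₂ (length u , here refl , subst (GapImage _ _) (sym length-u') (right g<u))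
  inherits {h} (there h∈) with Low.inherited (subst₂ (λ D n → h ∈ take (suc c) (reverse D ++ upTo n ∖ D)) Des-new length-u' h∈)
  ... | inj₁ h≡ = inj₁ h≡
  ... | inj₂ (h0 , h0∈ , image) =
        inj₂ (h0 , there (subst (λ D → h0 ∈ take (suc c) (reverse D ++ upTo (length u) ∖ D)) (sym Des-old) h0∈) , image)

gapOrder-tail-< : ∀ u → All (_< length u) (reverse (Des u) ++ upTo (length u) ∖ Des u)
gapOrder-tail-< u = ++⁺ (reverse⁺-All (Des-< u)) (filter⁺ (λ y → y ∉? Des u) (all-upTo (length u)))

length-gapOrder : ∀ u → suc (length u) ≤ length (gapOrder u)
length-gapOrder u = s≤s (begin
  length u                                           ≡⟨ sym (length-upTo (length u)) ⟩
  length (upTo (length u))                           ≤⟨ unique-length≤ (upTo (length u)) (Des u) (Unique.upTo⁺ (length u)) ⟩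
  length (Des u) + length (upTo (length u) ∖ Des u)  ≡⟨ cong (_+ length (upTo (length u) ∖ Des u)) (sym (length-reverse (Des u))) ⟩
  length (reverse (Des u)) + length (upTo (length u) ∖ Des u) ≡⟨ sym (length-++ (reverse (Des u))) ⟩
  length (reverse (Des u) ++ upTo (length u) ∖ Des u) ∎)
  where open ≤-Reasoning

gapOfLabel-suc-< : ∀ u c → c < length u → gapOfLabel u (suc c) < length u
gapOfLabel-suc-< u c c<u = All.lookup (gapOrder-tail-< u) (nth-∈ _ c (≤-pred (≤-trans (s≤s c<u) (length-gapOrder u))))

gapOfLabel-≤ : ∀ u c → c ≤ length u → gapOfLabel u c ≤ length u
gapOfLabel-≤ u zero    _   = ≤-refl
gapOfLabel-≤ u (suc c) c<u = <⇒≤ (gapOfLabel-suc-< u c c<u)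

gapOfLabel-∈ : ∀ u c → c ≤ length u → gapOfLabel u c ∈ take (suc c) (gapOrder u)
gapOfLabel-∈ u c c≤u = nth-∈-take (gapOrder u) c (≤-trans (s≤s c≤u) (length-gapOrder u))

drop-∷ : ∀ g (u : List ℕ) → g < length u → ∃ λ s → ∃ λ S → drop g u ≡ s ∷ S
drop-∷ zero    (x ∷ u) _        = x , u , refl
drop-∷ (suc g) (x ∷ u) (s≤s g<) = drop-∷ g u g<

length-take-≤ : ∀ g (u : List ℕ) → g ≤ length u → length (take g u) ≡ g
length-take-≤ zero    u       _        = refl
length-take-≤ (suc g) (x ∷ u) (s≤s g≤) = cong suc (length-take-≤ g u g≤)

inheritsLowGaps-insertAtGap : ∀ u a c g → All (_< a) u → c < length u → g < length u →
  gapOfLabel u (suc c) ≡ g → InheritsLowGaps (suc c) g u (insertAtGap g a u)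
inheritsLowGaps-insertAtGap u a c g <a c<u g<u label-g with drop-∷ g u g<u
... | s , S , drop≡ =
  subst₂ (InheritsLowGaps (suc c) g) (sym u≡) (sym inserted≡)
    (subst (λ x → InheritsLowGaps (suc c) x (P ++ s ∷ S) (P ++ a ∷ s ∷ S)) length-P
      (inheritsLowGaps-insert P s S a c (subst (All (_< a)) u≡ <a) (subst (c <_) (cong length u≡) c<u)
        (trans (cong (λ z → gapOfLabel z (suc c)) (sym u≡)) (trans label-g (sym length-P)))))
  where
  P = take g u
  length-P : length P ≡ g
  length-P = length-take-≤ g u (<⇒≤ g<u)
  u≡ : u ≡ P ++ s ∷ S
  u≡ = trans (sym (take++drop≡id g u)) (cong (P ++_) drop≡)
  inserted≡ : insertAtGap g a u ≡ P ++ a ∷ s ∷ S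
  inserted≡ = cong (λ z → P ++ a ∷ z) drop≡

inheritsLowGaps-gapOfLabel : ∀ u a c → All (_< a) u → c ≤ length u →
  InheritsLowGaps c (gapOfLabel u c) u (insertAtGap (gapOfLabel u c) a u)
inheritsLowGaps-gapOfLabel u a zero    _  _ (here h≡) = inj₁ (trans h≡ (length-insertAtGap (length u) a u))
inheritsLowGaps-gapOfLabel u a (suc c) <a c<u =
  inheritsLowGaps-insertAtGap u a c (gapOfLabel u (suc c)) <a c<u (gapOfLabel-suc-< u c c<u) refl

nth-insertAtGap-< : ∀ g a u i → i < g → g ≤ length u → nth (insertAtGap g a u) i ≡ nth u i
nth-insertAtGap-< (suc g) a (x ∷ u) zero    _        _        = refl
nth-insertAtGap-< (suc g) a (x ∷ u) (suc i) (s≤s i<) (s≤s g≤) = nth-insertAtGap-< g a u i i< g≤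

nth-insertAtGap-≥ : ∀ g a u i → g ≤ i → nth (insertAtGap g a u) (suc i) ≡ nth u i
nth-insertAtGap-≥ zero    a u       i       _        = refl
nth-insertAtGap-≥ (suc g) a []      i       _        = refl
nth-insertAtGap-≥ (suc g) a (x ∷ u) (suc i) (s≤s g≤) = nth-insertAtGap-≥ g a u i g≤

All-insertAtGap : ∀ {P : ℕ → Set} g a u → P a → All P u → All P (insertAtGap g a u)
All-insertAtGap g a u Pa Pu = ++⁺ (take⁺ g Pu) (Pa ∷ drop⁺ g Pu)

Linked-insertAtGap : ∀ {R : ℕ → ℕ → Set} g a u → Linked R u → (∀ {x} → x ∈ u → R x a) →
  (g < length u → R a (nth u g)) → Linked R (insertAtGap g a u)
Linked-insertAtGap zero          a []          _         _    _   = [-]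
Linked-insertAtGap zero          a (x ∷ u)     l         _    R-a = R-a (s≤s z≤n) ∷ l
Linked-insertAtGap (suc g)       a []          _         _    _   = [-]
Linked-insertAtGap (suc zero)    a (x ∷ u)     l         R-to R-a =
  R-to (here refl) ∷ Linked-insertAtGap zero a u (Linked.tail l) (R-to ∘ there) (R-a ∘ s≤s)
Linked-insertAtGap (suc (suc g)) a (x ∷ [])    _         R-to _   = R-to (here refl) ∷ [-]
Linked-insertAtGap (suc (suc g)) a (x ∷ y ∷ u) (Rxy ∷ l) R-to R-a =
  Rxy ∷ Linked-insertAtGap (suc g) a (y ∷ u) l (R-to ∘ there) (R-a ∘ s≤s)

module _ {k x : ℕ} (xs : List ℕ) where

  countLt-∷-< : x < k → countLt k (x ∷ xs) ≡ suc (countLt k xs)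
  countLt-∷-< x<k = cong length (filter-accept (_<? k) x<k)

  countLt-∷-≮ : ¬ x < k → countLt k (x ∷ xs) ≡ countLt k xs
  countLt-∷-≮ x≮k = cong length (filter-reject (_<? k) x≮k)

  countEq-∷-≡ : x ≡ k → countEq k (x ∷ xs) ≡ suc (countEq k xs)
  countEq-∷-≡ x≡k = cong length (filter-accept (_≟ k) x≡k)

  countEq-∷-≢ : x ≢ k → countEq k (x ∷ xs) ≡ countEq k xs
  countEq-∷-≢ x≢k = cong length (filter-reject (_≟ k) x≢k)

  removeLetter-∷-≢ : x ≢ k → removeLetter k (x ∷ xs) ≡ x ∷ removeLetter k xs
  removeLetter-∷-≢ x≢k = filter-accept (λ y → ¬? (y ≟ k)) x≢k

  removeLetter-∷-≡ : x ≡ k → removeLetter k (x ∷ xs) ≡ removeLetter k xs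
  removeLetter-∷-≡ x≡k = filter-reject (λ y → ¬? (y ≟ k)) (λ x≢k → x≢k x≡k)

countLt-∷-≤ : ∀ k x xs → countLt k xs ≤ countLt k (x ∷ xs)
countLt-∷-≤ k x xs with x <? k
... | yes x<k = ≤-trans (n≤1+n _) (≤-reflexive (sym (countLt-∷-< xs x<k)))
... | no  x≮k = ≤-reflexive (sym (countLt-∷-≮ xs x≮k))

rightOf-⊆ : ∀ i xs {y} → y ∈ rightOf i xs → y ∈ xs
rightOf-⊆ i (x ∷ xs) y∈ with x ≟ i
... | yes _ = there y∈
... | no  _ = there (rightOf-⊆ i xs y∈)

countLt-rightOf-≤ : ∀ k i xs → countLt k (rightOf i xs) ≤ countLt k xs
countLt-rightOf-≤ k i []       = z≤n
countLt-rightOf-≤ k i (x ∷ xs) with x ≟ i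
... | yes _ = countLt-∷-≤ k x xs
... | no  _ = ≤-trans (countLt-rightOf-≤ k i xs) (countLt-∷-≤ k x xs)

length-rightOf-< : ∀ i xs → i ∈ xs → length (rightOf i xs) < length xs
length-rightOf-< i (x ∷ xs) i∈ with x ≟ i
... | yes _   = ≤-refl
... | no  x≢i with i∈
...   | here i≡x  = ⊥-elim (x≢i (sym i≡x))
...   | there i∈′ = ≤-trans (length-rightOf-< i xs i∈′) (n≤1+n _)

rightOf-removeLetter : ∀ i b xs → i ≢ b → rightOf i (removeLetter b xs) ≡ removeLetter b (rightOf i xs)
rightOf-removeLetter i b []       i≢b = refl
rightOf-removeLetter i b (x ∷ xs) i≢b with x ≟ b
... | yes refl rewrite removeLetter-∷-≡ xs (refl {x = x}) with x ≟ i
...   | yes refl = ⊥-elim (i≢b refl)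
...   | no  _    = rightOf-removeLetter i b xs i≢b
rightOf-removeLetter i b (x ∷ xs) i≢b | no x≢b rewrite removeLetter-∷-≢ xs x≢b with x ≟ i
...   | yes refl = refl
...   | no  _    = rightOf-removeLetter i b xs i≢b

countLt-removeLetter : ∀ k b xs → k ≤ b → countLt k (removeLetter b xs) ≡ countLt k xs
countLt-removeLetter k b []       k≤b = refl
countLt-removeLetter k b (x ∷ xs) k≤b with x ≟ b
... | yes refl rewrite removeLetter-∷-≡ xs (refl {x = x}) | countLt-∷-≮ {k} xs (λ x<k → <-irrefl refl (<-≤-trans x<k k≤b)) =
      countLt-removeLetter k b xs k≤b
... | no  x≢b rewrite removeLetter-∷-≢ xs x≢b with x <? k
...   | yes x<k rewrite countLt-∷-< (removeLetter b xs) x<k | countLt-∷-< xs x<k = cong suc (countLt-removeLetter k b xs k≤b)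
...   | no  x≮k rewrite countLt-∷-≮ (removeLetter b xs) x≮k | countLt-∷-≮ xs x≮k = countLt-removeLetter k b xs k≤b

countLt-suc-∉ : ∀ j ys → j ∉ ys → countLt (suc j) ys ≡ countLt j ys
countLt-suc-∉ j []       _   = refl
countLt-suc-∉ j (y ∷ ys) j∉ with y <? suc j | y <? j
... | yes y<1+j | yes y<j rewrite countLt-∷-< ys y<1+j | countLt-∷-< ys y<j = cong suc (countLt-suc-∉ j ys (j∉ ∘ there))
... | yes y<1+j | no  y≮j = ⊥-elim (j∉ (here (≤-antisym (≮⇒≥ y≮j) (≤-pred y<1+j))))
... | no  y≮1+j | yes y<j = ⊥-elim (y≮1+j (≤-trans y<j (n≤1+n _)))
... | no  y≮1+j | no  y≮j rewrite countLt-∷-≮ ys y≮1+j | countLt-∷-≮ ys y≮j = countLt-suc-∉ j ys (j∉ ∘ there)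

removeLetter-∉ : ∀ a xs → a ∉ xs → removeLetter a xs ≡ xs
removeLetter-∉ a []       _  = refl
removeLetter-∉ a (x ∷ xs) a∉ with x ≟ a
... | yes refl = ⊥-elim (a∉ (here refl))
... | no  x≢a rewrite removeLetter-∷-≢ xs x≢a = cong (x ∷_) (removeLetter-∉ a xs (a∉ ∘ there))

length-removeLetter : ∀ a xs → Unique xs → a ∈ xs → suc (length (removeLetter a xs)) ≡ length xs
length-removeLetter a (x ∷ xs) (x∉ ∷ u) a∈ with x ≟ a
... | yes refl rewrite removeLetter-∷-≡ xs (refl {x = x}) =
      cong (suc ∘ length) (removeLetter-∉ x xs (λ x∈ → All.lookup x∉ x∈ refl))
... | no  x≢a rewrite removeLetter-∷-≢ xs x≢a with a∈
...   | here a≡x  = ⊥-elim (x≢a (sym a≡x))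
...   | there a∈′ = cong suc (length-removeLetter a xs u a∈′)

-- code π n is c_{n+1}(π)
code : List ℕ → ℕ → ℕ
code π n = nth (invCode π) n

code≡ : ∀ π n → n < length π → code π n ≡ countLt (suc n) (rightOf (suc n) π)
code≡ π n n<π = begin
  nth (map (λ i → countLt i (rightOf i π)) (map suc (upTo (length π)))) n
    ≡⟨ nth-map (λ i → countLt i (rightOf i π)) (map suc (upTo (length π))) n n<len ⟩
  countLt (nth (map suc (upTo (length π))) n) (rightOf (nth (map suc (upTo (length π))) n) π)
    ≡⟨ cong (λ i → countLt i (rightOf i π)) (trans (cong (λ z → nth z n) (map-upTo suc (length π))) (nth-applyUpTo suc (length π) n n<π)) ⟩
  countLt (suc n) (rightOf (suc n) π) ∎
  where
  open ≡-Reasoning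
  n<len : n < length (map suc (upTo (length π)))
  n<len = subst (n <_) (sym (trans (length-map suc (upTo (length π))) (length-upTo (length π)))) n<π

InBlockOrder : (ℕ → ℕ) → ℕ → ℕ → Set
InBlockOrder f x y = f x ≡ f y → x < y

module PsiBlocks (block : ℕ → ℕ) (block-mono : ∀ {x y} → x ≤ y → block x ≤ block y) where

  SameBlockCodes : ℕ → List ℕ → Set
  SameBlockCodes zero    π = ⊤
  SameBlockCodes (suc n) π = block (suc n) ≡ block (suc (suc n)) →
                             code π (suc n) ≤ code (removeLetter (suc (suc n)) π) n

  CodeCondition : ℕ → List ℕ → Set
  CodeCondition zero    π = ⊤
  CodeCondition (suc n) π = CodeCondition n (removeLetter (suc n) π) × code π n ≤ n × SameBlockCodes n π

  Separated : List ℕ → Set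
  Separated = Linked (DescentSeparated block)

  record Built (n : ℕ) (u : List ℕ) : Set where
    field
      length≡   : length u ≡ n
      bounded   : All (_≤ n) u
      separated : Separated u

  -- Gap p lies directly in front of the letter nth u p.
  GuardedGaps : ℕ → ℕ → List ℕ → Set
  GuardedGaps b c u = ∀ p → p < length u → block (nth u p) ≡ block b → p ∉ take (suc c) (gapOrder u)

  insertLargest : ∀ n ℓ u → Built n u → ℓ ≤ n → GuardedGaps (suc n) ℓ u →
    let u' = insertAtGap (gapOfLabel u ℓ) (suc n) u in Built (suc n) u' × GuardedGaps (suc n) ℓ u'
  insertLargest n ℓ u built ℓ≤n guarded = record
    { length≡   = trans (length-insertAtGap g (suc n) u) (cong suc length≡)
    ; bounded   = All-insertAtGap g (suc n) u ≤-refl (All.map (λ x≤n → ≤-trans x≤n (n≤1+n n)) bounded)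
    ; separated = Linked-insertAtGap g (suc n) u separated
                    (λ x∈ a<x → ⊥-elim (<-asym (≤-trans a<x (All.lookup bounded x∈)) (n<1+n n)))
                    (λ g<u _ same → guarded g g<u same g∈)
    } , guarded'
    where
    open Built built
    ℓ≤u = subst (ℓ ≤_) (sym length≡) ℓ≤n
    g = gapOfLabel u ℓ
    g≤u = gapOfLabel-≤ u ℓ ℓ≤u
    g∈ = gapOfLabel-∈ u ℓ ℓ≤u
    u' = insertAtGap g (suc n) u
    length-u' = length-insertAtGap g (suc n) u
    guarded' : GuardedGaps (suc n) ℓ u'
    guarded' p p<u' same p∈ with inheritsLowGaps-gapOfLabel u (suc n) ℓ (All.map s≤s bounded) ℓ≤u p∈
    ... | inj₁ refl = guarded g (≤-pred (subst (suc g <_) length-u' p<u'))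
                        (trans (cong block (sym (nth-insertAtGap-≥ g (suc n) u g ≤-refl))) same) g∈
    ... | inj₂ (h0 , h0∈ , left h0<g) =
          guarded h0 (<-≤-trans h0<g g≤u) (trans (cong block (sym (nth-insertAtGap-< g (suc n) u h0 h0<g g≤u))) same) h0∈
    ... | inj₂ (h0 , h0∈ , right g<h0) =
          guarded h0 (≤-pred (subst (suc h0 <_) length-u' p<u'))
            (trans (cong block (sym (nth-insertAtGap-≥ g (suc n) u h0 (<⇒≤ g<h0)))) same) h0∈

  GuardedAfter : ℕ → List ℕ → Set
  GuardedAfter zero    π = ⊤
  GuardedAfter (suc n) π = GuardedGaps (suc n) (code π n) (psiGo (suc n) π)

  -- A letter ≤ m + 1 can share the block of m + 2 only if m + 1 does, as block is weakly increasing.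
  guarded-before-insert : ∀ m π → SameBlockCodes m π →
    let π' = removeLetter (suc m) π in
    GuardedAfter m π' → Built m (psiGo m π') → GuardedGaps (suc m) (code π m) (psiGo m π')
  guarded-before-insert zero    π _ _ built p p<u = ⊥-elim (n≮0 (subst (p <_) (Built.length≡ built) p<u))
  guarded-before-insert (suc m) π codes≤ guarded built p p<u same-p with block (suc m) ≟ block (suc (suc m))
  ... | yes same-block = guarded p p<u (trans same-p (sym same-block)) ∘ ∈-take-mono _ (s≤s (codes≤ same-block))
  ... | no  other      = ⊥-elim (other (≤-antisym (block-mono (n≤1+n (suc m)))
                           (subst (_≤ block (suc m)) same-p (block-mono (All.lookup (Built.bounded built) (nth-∈ _ p p<u))))))

  psiGo-built : ∀ n π → CodeCondition n π → Built n (psiGo n π) × GuardedAfter n π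
  psiGo-built zero    π _ = record { length≡ = refl ; bounded = [] ; separated = [] } , tt
  psiGo-built (suc n) π (condition , code≤n , codes≤) =
    insertLargest n (code π n) (psiGo n π') built code≤n (guarded-before-insert n π codes≤ guarded built)
    where
    π' = removeLetter (suc n) π
    built = proj₁ (psiGo-built n π' condition)
    guarded = proj₂ (psiGo-built n π' condition)

  record BlockSorted (n : ℕ) (π : List ℕ) : Set where
    field
      range   : All (λ y → 1 ≤ y × y ≤ n) π
      length≡ : length π ≡ n
      in-block-order : AllPairs (InBlockOrder block) π

    unique : Unique π
    unique = AllPairs.map (λ ordered s≡s' → <-irrefl s≡s' (ordered (cong block s≡s'))) in-block-order

  max∈ : ∀ {n π} → BlockSorted (suc n) π → suc n ∈ π
  max∈ {n} {π} bs with suc n ∈? π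
  ... | yes n+1∈ = n+1∈
  ... | no  n+1∉ = ⊥-elim (1+n≰n (begin
        suc n                     ≡⟨ sym length≡ ⟩
        length π                  ≤⟨ unique-⊆⇒length≤ π (map suc (upTo n)) unique π⊆ ⟩
        length (map suc (upTo n)) ≡⟨ trans (length-map suc (upTo n)) (length-upTo n) ⟩
        n                         ∎))
    where
    open BlockSorted bs
    open ≤-Reasoning
    π⊆ : ∀ {y} → y ∈ π → y ∈ map suc (upTo n)
    π⊆ {zero}  y∈ with () ← proj₁ (All.lookup range y∈)
    π⊆ {suc y} y∈ = ∈-map⁺ suc (∈-upTo⁺ (≤∧≢⇒< (≤-pred (proj₂ (All.lookup range y∈))) (λ { refl → n+1∉ y∈ })))

  removeLetter-blockSorted : ∀ {n π} → BlockSorted (suc n) π → BlockSorted n (removeLetter (suc n) π)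
  removeLetter-blockSorted {n} {π} bs = record
    { range   = All.tabulate in-range
    ; length≡ = suc-injective (trans (length-removeLetter (suc n) π unique (max∈ bs)) length≡)
    ; in-block-order = AllPairsₚ.filter⁺ keep? in-block-order
    }
    where
    open BlockSorted bs
    keep? = λ y → ¬? (y ≟ suc n)
    in-range : ∀ {y} → y ∈ removeLetter (suc n) π → 1 ≤ y × y ≤ n
    in-range y∈ with ∈-filter⁻ keep? {xs = π} y∈
    ... | y∈π , y≢ with All.lookup range y∈π
    ...   | 1≤y , y≤ = 1≤y , ≤-pred (≤∧≢⇒< y≤ y≢)

  -- j precedes j + 1 in π, so what lies right of j + 1 lies right of j, and contains no j.
  countLt-rightOf-same-block : ∀ j π → AllPairs (InBlockOrder block) π → Unique π → j ∈ π → suc j ∈ π →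
    block j ≡ block (suc j) → countLt (suc j) (rightOf (suc j) π) ≤ countLt j (rightOf j π)
  countLt-rightOf-same-block j (x ∷ xs) (x-ord ∷ ord) (x∉ ∷ u) j∈ j+1∈ same with x ≟ j | x ≟ suc j
  ... | yes refl | yes x≡1+x = ⊥-elim (<-irrefl x≡1+x (n<1+n x))
  ... | yes refl | no  _     = ≤-trans
        (≤-reflexive (countLt-suc-∉ x (rightOf (suc x) xs) (λ x∈ → All.lookup x∉ (rightOf-⊆ (suc x) xs x∈) refl)))
        (countLt-rightOf-≤ x (suc x) xs)
  ... | no  x≢j  | yes refl with j∈
  ...   | here j≡x  = ⊥-elim (x≢j (sym j≡x))
  ...   | there j∈′ = ⊥-elim (<-asym (All.lookup x-ord j∈′ (sym same)) (n<1+n j))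
  countLt-rightOf-same-block j (x ∷ xs) (_ ∷ ord) (_ ∷ u) j∈ j+1∈ same | no x≢j | no x≢1+j with j∈ | j+1∈
  ... | here j≡x  | _           = ⊥-elim (x≢j (sym j≡x))
  ... | _         | here j+1≡x  = ⊥-elim (x≢1+j (sym j+1≡x))
  ... | there j∈′ | there j+1∈′ = countLt-rightOf-same-block j xs ord u j∈′ j+1∈′ same

  code≤ : ∀ {n π} → BlockSorted (suc n) π → code π n ≤ n
  code≤ {n} {π} bs = ≤-pred (begin-strict
    code π n                               ≡⟨ code≡ π n n<π ⟩
    countLt (suc n) (rightOf (suc n) π)    ≤⟨ length-filter (_<? suc n) (rightOf (suc n) π) ⟩
    length (rightOf (suc n) π)             <⟨ length-rightOf-< (suc n) π (max∈ bs) ⟩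
    length π                               ≡⟨ length≡ ⟩
    suc n                                  ∎)
    where
    open BlockSorted bs
    open ≤-Reasoning
    n<π = subst (n <_) (sym length≡) ≤-refl

  sameBlockCodes : ∀ n {π} → BlockSorted (suc n) π → SameBlockCodes n π
  sameBlockCodes zero    _  = tt
  sameBlockCodes (suc m) {π} bs same = begin
    code π (suc m)                                     ≡⟨ code≡ π (suc m) (subst (suc m <_) (sym length≡) ≤-refl) ⟩
    countLt (suc (suc m)) (rightOf (suc (suc m)) π)    ≤⟨ countLt-rightOf-same-block (suc m) π in-block-order unique
                                                            m+1∈ (max∈ bs) same ⟩
    countLt (suc m) (rightOf (suc m) π)                ≡⟨ sym (countLt-removeLetter (suc m) (suc (suc m)) (rightOf (suc m) π) (n≤1+n _)) ⟩
    countLt (suc m) (removeLetter (suc (suc m)) (rightOf (suc m) π))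
      ≡⟨ cong (countLt (suc m)) (sym (rightOf-removeLetter (suc m) (suc (suc m)) π (λ m+1≡m+2 → <-irrefl m+1≡m+2 (n<1+n _)))) ⟩
    countLt (suc m) (rightOf (suc m) π')               ≡⟨ sym (code≡ π' m (subst (m <_) (sym (BlockSorted.length≡ bs')) ≤-refl)) ⟩
    code π' m                                          ∎
    where
    open BlockSorted bs
    open ≤-Reasoning
    π' = removeLetter (suc (suc m)) π
    bs' = removeLetter-blockSorted bs
    m+1∈ : suc m ∈ π
    m+1∈ = proj₁ (∈-filter⁻ (λ y → ¬? (y ≟ suc (suc m))) {xs = π} (max∈ bs'))

  blockSorted⇒codeCondition : ∀ n {π} → BlockSorted n π → CodeCondition n π
  blockSorted⇒codeCondition zero    _  = tt
  blockSorted⇒codeCondition (suc n) bs =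
    blockSorted⇒codeCondition n (removeLetter-blockSorted bs) , code≤ bs , sameBlockCodes n bs

module _ {P : ℕ → Set} (P? : ∀ x → Dec (P x)) where

  length-filter-++ : ∀ xs ys → length (filter P? (xs ++ ys)) ≡ length (filter P? xs) + length (filter P? ys)
  length-filter-++ xs ys = trans (cong length (filter-++ P? xs ys)) (length-++ (filter P? xs))

  length-filter-replicate : ∀ k {x} → P x → length (filter P? (replicate k x)) ≡ k
  length-filter-replicate k Px = trans (cong length (filter-all P? (replicate⁺ k Px))) (length-replicate k)

  length-filter-none : ∀ {xs} → All (λ x → ¬ P x) xs → length (filter P? xs) ≡ 0
  length-filter-none ¬Pxs = cong length (filter-none P? ¬Pxs)

  length-filter-↭ : ∀ {xs ys} → xs ↭ ys → length (filter P? xs) ≡ length (filter P? ys)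
  length-filter-↭ xs↭ys = ↭-length (filter-↭ P? xs↭ys)

countLt+countEq≤length : ∀ y xs → countLt y xs + countEq y xs ≤ length xs
countLt+countEq≤length y []       = z≤n
countLt+countEq≤length y (x ∷ xs) with x <? y | x ≟ y
... | yes x<y | yes refl = ⊥-elim (<-irrefl refl x<y)
... | yes x<y | no  x≢y rewrite countLt-∷-< xs x<y | countEq-∷-≢ xs x≢y = s≤s (countLt+countEq≤length y xs)
... | no  x≮y | yes x≡y rewrite countLt-∷-≮ xs x≮y | countEq-∷-≡ xs x≡y =
      subst (_≤ suc (length xs)) (sym (+-suc _ _)) (s≤s (countLt+countEq≤length y xs))
... | no  x≮y | no  x≢y rewrite countLt-∷-≮ xs x≮y | countEq-∷-≢ xs x≢y = ≤-trans (countLt+countEq≤length y xs) (n≤1+n _)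

istdLetter-≥ : ∀ ks t v → t ≤ istdLetter ks t v
istdLetter-≥ []       t v = ≤-refl
istdLetter-≥ (k ∷ ks) t v with v ≤? k
... | yes _ = ≤-refl
... | no  _ = ≤-trans (n≤1+n t) (istdLetter-≥ ks (suc t) (v ∸ k))

istdLetter-mono : ∀ ks t {x y} → x ≤ y → istdLetter ks t x ≤ istdLetter ks t y
istdLetter-mono []       t x≤y = ≤-refl
istdLetter-mono (k ∷ ks) t {x} {y} x≤y with x ≤? k | y ≤? k
... | yes _   | yes _   = ≤-refl
... | yes _   | no  _   = ≤-trans (n≤1+n t) (istdLetter-≥ ks (suc t) (y ∸ k))
... | no  x≰k | yes y≤k = ⊥-elim (x≰k (≤-trans x≤y y≤k))
... | no  _   | no  _   = istdLetter-mono ks (suc t) (∸-monoˡ-≤ k x≤y)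

baseFrom-≥ : ∀ ks t → All (t ≤_) (baseFrom t ks)
baseFrom-≥ []       t = []
baseFrom-≥ (k ∷ ks) t = ++⁺ (replicate⁺ k ≤-refl) (All.map (≤-trans (n≤1+n t)) (baseFrom-≥ ks (suc t)))

countLt-baseFrom-self : ∀ ks t → countLt t (baseFrom t ks) ≡ 0
countLt-baseFrom-self ks t = length-filter-none (_<? t) (All.map (λ t≤y y<t → <-irrefl refl (<-≤-trans y<t t≤y)) (baseFrom-≥ ks t))

countEq-baseFrom-self : ∀ k ks t → countEq t (baseFrom t (k ∷ ks)) ≡ k
countEq-baseFrom-self k ks t = begin
  countEq t (replicate k t ++ baseFrom (suc t) ks)                 ≡⟨ length-filter-++ (_≟ t) (replicate k t) _ ⟩
  countEq t (replicate k t) + countEq t (baseFrom (suc t) ks)      ≡⟨ cong₂ _+_ (length-filter-replicate (_≟ t) k refl)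
                                                                       (length-filter-none (_≟ t) (All.map (λ t<y y≡t → <-irrefl (sym y≡t) t<y) (baseFrom-≥ ks (suc t)))) ⟩
  k + 0                                                            ≡⟨ +-identityʳ k ⟩
  k                                                                ∎
  where open ≡-Reasoning

countLt-baseFrom-< : ∀ k ks {t y} → t < y → countLt y (baseFrom t (k ∷ ks)) ≡ k + countLt y (baseFrom (suc t) ks)
countLt-baseFrom-< k ks {t} {y} t<y =
  trans (length-filter-++ (_<? y) (replicate k t) _) (cong (_+ _) (length-filter-replicate (_<? y) k t<y))

countEq-baseFrom-≢ : ∀ k ks {t y} → t ≢ y → countEq y (baseFrom t (k ∷ ks)) ≡ countEq y (baseFrom (suc t) ks)
countEq-baseFrom-≢ k ks {t} {y} t≢y =
  trans (length-filter-++ (_≟ y) (replicate k t) _) (cong (_+ _) (length-filter-none (_≟ y) (replicate⁺ k t≢y)))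

istdLetter-head : ∀ k ks t {v} → v ≤ k → istdLetter (k ∷ ks) t v ≡ t
istdLetter-head k ks t {v} v≤k with v ≤? k
... | yes _   = refl
... | no  v≰k = ⊥-elim (v≰k v≤k)

istdLetter-tail : ∀ k ks t {v} → ¬ v ≤ k → istdLetter (k ∷ ks) t v ≡ istdLetter ks (suc t) (v ∸ k)
istdLetter-tail k ks t {v} v≰k with v ≤? k
... | yes v≤k = ⊥-elim (v≰k v≤k)
... | no  _   = refl

-- The values 1 + #{letters < y} + e, for e < #{letters = y}, are the positions of y in the sorted word.
istdLetter-baseFrom : ∀ ks t y e → t ≤ y → e < countEq y (baseFrom t ks) →
  istdLetter ks t (suc (countLt y (baseFrom t ks) + e)) ≡ y
istdLetter-baseFrom (k ∷ ks) t y e t≤y e< with t ≟ y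
... | yes refl = begin
  istdLetter (k ∷ ks) t (suc (countLt t (baseFrom t (k ∷ ks)) + e)) ≡⟨ cong (λ z → istdLetter (k ∷ ks) t (suc (z + e))) (countLt-baseFrom-self (k ∷ ks) t) ⟩
  istdLetter (k ∷ ks) t (suc e)                                     ≡⟨ istdLetter-head k ks t (subst (e <_) (countEq-baseFrom-self k ks t) e<) ⟩
  t                                                                 ∎
  where open ≡-Reasoning
... | no  t≢y = begin
  istdLetter (k ∷ ks) t (suc (countLt y (baseFrom t (k ∷ ks)) + e)) ≡⟨ cong (istdLetter (k ∷ ks) t) v≡ ⟩
  istdLetter (k ∷ ks) t (k + suc r)                                 ≡⟨ istdLetter-tail k ks t (λ k+r<k → m+1+n≰m k k+r<k) ⟩
  istdLetter ks (suc t) (k + suc r ∸ k)                             ≡⟨ cong (istdLetter ks (suc t)) (m+n∸m≡n k (suc r)) ⟩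
  istdLetter ks (suc t) (suc r)                                     ≡⟨ istdLetter-baseFrom ks (suc t) y e t<y (subst (e <_) (countEq-baseFrom-≢ k ks t≢y) e<) ⟩
  y                                                                 ∎
  where
  open ≡-Reasoning
  t<y = ≤∧≢⇒< t≤y t≢y
  r = countLt y (baseFrom (suc t) ks) + e
  v≡ : suc (countLt y (baseFrom t (k ∷ ks)) + e) ≡ k + suc r
  v≡ = trans (cong (λ z → suc (z + e)) (countLt-baseFrom-< k ks t<y))
             (trans (cong suc (+-assoc k _ e)) (sym (+-suc k r)))

countEq-prefix-< : ∀ pre x rest → countEq x pre < countEq x (pre ++ x ∷ rest)
countEq-prefix-< pre x rest = begin-strict
  countEq x pre                          <⟨ m<m+n (countEq x pre) (s≤s z≤n) ⟩
  countEq x pre + suc (countEq x rest)   ≡⟨ cong (countEq x pre +_) (sym (countEq-∷-≡ rest refl)) ⟩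
  countEq x pre + countEq x (x ∷ rest)   ≡⟨ sym (length-filter-++ (_≟ x) pre (x ∷ rest)) ⟩
  countEq x (pre ++ x ∷ rest)            ∎
  where open ≤-Reasoning

countEq-snoc-≤ : ∀ x pre y → countEq x pre ≤ countEq x (pre ++ [ y ])
countEq-snoc-≤ x pre y = subst (countEq x pre ≤_) (sym (length-filter-++ (_≟ x) pre [ y ])) (m≤m+n _ _)

module Standardization (ks w : List ℕ) (w↭ : w ↭ baseWord ks) where

  block : ℕ → ℕ
  block = istdLetter ks 1

  open PsiBlocks block (istdLetter-mono ks 1) using (BlockSorted)

  rank : List ℕ → ℕ → ℕ
  rank pre x = suc (countLt x w + countEq x pre)

  block-rank : ∀ pre x rest → pre ++ x ∷ rest ≡ w → block (rank pre x) ≡ x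
  block-rank pre x rest refl =
    subst (λ n → block (suc (n + countEq x pre)) ≡ x) (sym (length-filter-↭ (_<? x) w↭))
      (istdLetter-baseFrom ks 1 x (countEq x pre) 1≤x
        (subst (countEq x pre <_) (length-filter-↭ (_≟ x) w↭) (countEq-prefix-< pre x rest)))
    where
    1≤x = All.lookup (baseFrom-≥ ks 1) (∈-resp-↭ w↭ (∈-++⁺ʳ pre (here refl)))

  stdGo-after : ∀ pre ys → pre ++ ys ≡ w → ∀ x c → c < countEq x pre → block (suc (countLt x w + c)) ≡ x →
    All (InBlockOrder block (suc (countLt x w + c))) (stdGo w pre ys)
  stdGo-after pre []       _  _ _ _  _       = []
  stdGo-after pre (y ∷ ys) pre-ys≡w x c c< block-x =
    in-order ∷ stdGo-after (pre ++ [ y ]) ys (trans (++-assoc pre [ y ] ys) pre-ys≡w) x c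
                 (≤-trans c< (countEq-snoc-≤ x pre y)) block-x
    where
    in-order : InBlockOrder block (suc (countLt x w + c)) (rank pre y)
    in-order same with trans (sym block-x) (trans same (block-rank pre y ys pre-ys≡w))
    ... | refl = s≤s (+-monoʳ-< (countLt x w) c<)

  stdGo-in-block-order : ∀ pre ys → pre ++ ys ≡ w → AllPairs (InBlockOrder block) (stdGo w pre ys)
  stdGo-in-block-order pre []       _        = []
  stdGo-in-block-order pre (x ∷ ys) pre-ys≡w =
    stdGo-after (pre ++ [ x ]) ys pre-ys≡w′ x (countEq x pre) (countEq-prefix-< pre x []) (block-rank pre x ys pre-ys≡w)
    ∷ stdGo-in-block-order (pre ++ [ x ]) ys pre-ys≡w′
    where pre-ys≡w′ = trans (++-assoc pre [ x ] ys) pre-ys≡w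

  stdGo-range : ∀ pre ys → pre ++ ys ≡ w → All (λ s → 1 ≤ s × s ≤ length w) (stdGo w pre ys)
  stdGo-range pre []       _        = []
  stdGo-range pre (x ∷ ys) pre-ys≡w =
    (s≤s z≤n , rank≤) ∷ stdGo-range (pre ++ [ x ]) ys (trans (++-assoc pre [ x ] ys) pre-ys≡w)
    where
    rank≤ : rank pre x ≤ length w
    rank≤ = ≤-trans (+-monoʳ-< (countLt x w) (subst (λ v → countEq x pre < countEq x v) pre-ys≡w (countEq-prefix-< pre x ys)))
                    (countLt+countEq≤length x w)

  length-stdGo : ∀ pre ys → length (stdGo w pre ys) ≡ length ys
  length-stdGo pre []       = refl
  length-stdGo pre (x ∷ ys) = cong suc (length-stdGo (pre ++ [ x ]) ys)

  std-blockSorted : BlockSorted (length (std w)) (std w)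
  std-blockSorted = record
    { range   = subst (λ n → All (λ s → 1 ≤ s × s ≤ n) (std w)) (sym (length-stdGo [] w)) (stdGo-range [] w refl)
    ; length≡ = refl
    ; in-block-order = stdGo-in-block-order [] w refl
    }

lemma6p6 : (ks : List ℕ) → All (λ k → 1 ≤ k) ks → (w : List ℕ) → w ↭ baseWord ks →
    Des (istd ks (Ψ (std w))) ≡ Des (Ψ (std w))
lemma6p6 ks _ w w↭ = Des-map (istdLetter-mono ks 1) (Ψ (std w)) (Built.separated built)
  where
  open Standardization ks w w↭
  open PsiBlocks block (istdLetter-mono ks 1)
  built : Built (length (std w)) (Ψ (std w))
  built = proj₁ (psiGo-built (length (std w)) (std w) (blockSorted⇒codeCondition _ std-blockSorted))
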